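{- For every integer $k \ge 2$, every graph $G$ with $\beta^k(G) > 0$ is connected.
   Context: All graphs are finite and simple. For $S\subseteq V(G)$, $\Lambda^k_G(S)$ is the set of vertices with at least $k$ neighbors in $S$, and $\beta^k(G)=\min\{|\Lambda^k_G(S)|/|S| : S\subseteq V(G),\ |S|\ge k,\ \Lambda^k_G(S)\ne V(G)\}$, with $\beta^k(G)=0$ if $|V(G)|<k$. -}

module Defs where

open import Data.Bool using (Bool; true; false; _∧_; not; if_then_else_)
open import Data.Bool.Properties using () renaming (_≟_ to _≟𝔹_)
open import Data.Nat using (ℕ; zero; suc; _≤ᵇ_; _<ᵇ_)
open import Data.Integer using (+_)
open import Data.Rational using (ℚ; 0ℚ; _/_; _⊓_)
open import Data.Fin using (Fin)
open import Data.Fin.Subset using (Subset; _∩_; ∣_∣; ⊤; inside; outside)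
open import Data.Vec using (Vec; []; _∷_; tabulate)
open import Data.Vec.Properties using (≡-dec)
open import Data.List using (List; []; _∷_; _++_; map; filter)
open import Relation.Nullary.Decidable using (does)
open import Relation.Binary.PropositionalEquality using (_≡_)

record Graph : Set where
  field
    n      : ℕ
    adj    : Fin n → Fin n → Bool
    sym    : ∀ u v → adj u v ≡ adj v u
    irrefl : ∀ v → adj v v ≡ false
open Graph public

N : (G : Graph) → Fin (n G) → Subset (n G)
N G u = tabulate (adj G u)

Λ : ℕ → (G : Graph) → Subset (n G) → Subset (n G)
Λ k G S = tabulate (λ u → k ≤ᵇ ∣ S ∩ N G u ∣)

allSubsets : (m : ℕ) → List (Subset m)
allSubsets zero    = [] ∷ []
allSubsets (suc m) = map (inside ∷_) (allSubsets m) ++ map (outside ∷_) (allSubsets m)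

admissible : ℕ → (G : Graph) → Subset (n G) → Bool
admissible k G S = (k ≤ᵇ ∣ S ∣) ∧ not (does (≡-dec _≟𝔹_ (Λ k G S) ⊤))

-- |Λ^k_G(S)| / |S| (|S| > 0 whenever k ≥ 1 and S is admissible).
ratio : ℕ → (G : Graph) → Subset (n G) → ℚ
ratio k G S with ∣ S ∣
... | zero  = 0ℚ
... | suc m = (+ ∣ Λ k G S ∣) / suc m

-- minimum of a list of rationals (0 for the empty list; unused when n ≥ k ≥ 1,
-- since every S with |S| = k is admissible).
minimumℚ : List ℚ → ℚ
minimumℚ []       = 0ℚ
minimumℚ (x ∷ []) = x
minimumℚ (x ∷ xs@(_ ∷ _)) = x ⊓ minimumℚ xs

β : ℕ → Graph → ℚ
β k G = if n G <ᵇ k then 0ℚ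
        else minimumℚ (map (ratio k G) (filter (λ S → admissible k G S ≟𝔹 true) (allSubsets (n G))))

data Reachable (G : Graph) : Fin (n G) → Fin (n G) → Set where
  here : ∀ {u} → Reachable G u u
  step : ∀ {u v w} → adj G u v ≡ true → Reachable G v w → Reachable G u w

Connected : Graph → Set
Connected G = ∀ u v → Reachable G u v

{-# OPTIONS --safe #-}

-- Given vertices u and v, enlarge {u, v} (at most 2 ≤ k elements) to a set S
-- of exactly k vertices.  If no vertex had k neighbours in S, then
-- Λ^k(S) = ∅ ≠ V(G) and S would witness β^k(G) ≤ |∅| / k = 0.  So some w has
-- k neighbours in the k-set S, i.e. all of S, and u – w – v is a walk.

module Submission where

open import Defs hiding (sym)
open import Data.Rational using (0ℚ; _<_)
open import Data.Bool using (Bool; true; false; _∧_; not; T)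
open import Data.Bool.Properties using (T-≡; T-∧) renaming (_≟_ to _≟𝔹_)
open import Data.Nat using (ℕ; _≤_; zero; suc; _+_; _∸_; _≤ᵇ_; _<ᵇ_; z≤n; s≤s; s≤s⁻¹)
open import Data.Nat.Properties
  using (≤-reflexive; ≤-trans; <⇒≱; ≮⇒≥; +-suc; +-monoʳ-≤; n≤1+n; m+[n∸m]≡n; ≤ᵇ⇒≤; ≤⇒≤ᵇ; <ᵇ⇒<; <⇒<ᵇ; +-identityʳ)
open import Data.Fin using (Fin)
open import Data.Fin.Subset using (Subset; _∈_; _⊆_; _⊂_; _∩_; _∪_; ∣_∣; ⊤; ⁅_⁆; inside; outside; Nonempty; Empty)
open import Data.Fin.Subset.Properties
  using (_∈?_; p⊂q⇒∣p∣<∣q∣; p∩q⊆p; x∈p∩q⁻; p⊆p∪q; q⊆p∪q; x∈⁅x⁆; ∣⁅x⁆∣≡1; ∣p∣≤n; ∈⊤; nonempty?; Empty-unique; ∣⊥∣≡0)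
open import Data.Vec using ([]; _∷_; tabulate; here; there)
open import Data.Vec.Properties using (≡-dec; lookup∘tabulate; []=⇒lookup)
open import Data.List using () renaming ([] to []ˡ; _∷_ to _∷ˡ_)
open import Data.List.Membership.Propositional using () renaming (_∈_ to _∈ˡ_)
open import Data.List.Membership.Propositional.Properties using (∈-map⁺; ∈-++⁺ˡ; ∈-++⁺ʳ; ∈-filter⁺)
open import Data.List.Relation.Unary.Any using () renaming (here to hereˡ; there to thereˡ)
import Data.Rational as ℚ
import Data.Rational.Properties as ℚ
open import Data.Product using (_×_; _,_; proj₁; proj₂; ∃-syntax)
open import Function using (_∘_)
open import Function.Bundles using (Equivalence)
open import Relation.Nullary using (yes; no; contradiction)
open import Relation.Nullary.Decidable using (dec-false)
open import Relation.Binary.PropositionalEquality using (_≡_; _≢_; refl; sym; trans; cong; cong₂; subst)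

open Equivalence using (to; from)

private variable
  m : ℕ

∣p∪q∣≤∣p∣+∣q∣ : ∀ (p q : Subset m) → ∣ p ∪ q ∣ ≤ ∣ p ∣ + ∣ q ∣
∣p∪q∣≤∣p∣+∣q∣ []            []            = z≤n
∣p∪q∣≤∣p∣+∣q∣ (outside ∷ p) (outside ∷ q) = ∣p∪q∣≤∣p∣+∣q∣ p q
∣p∪q∣≤∣p∣+∣q∣ (outside ∷ p) (inside ∷ q)  =
  ≤-trans (s≤s (∣p∪q∣≤∣p∣+∣q∣ p q)) (≤-reflexive (sym (+-suc ∣ p ∣ ∣ q ∣)))
∣p∪q∣≤∣p∣+∣q∣ (inside ∷ p)  (outside ∷ q) = s≤s (∣p∪q∣≤∣p∣+∣q∣ p q)
∣p∪q∣≤∣p∣+∣q∣ (inside ∷ p)  (inside ∷ q)  =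
  s≤s (≤-trans (∣p∪q∣≤∣p∣+∣q∣ p q) (+-monoʳ-≤ ∣ p ∣ (n≤1+n ∣ q ∣)))

∣p∣≤∣p∩q∣⇒p⊆q : ∀ (p q : Subset m) → ∣ p ∣ ≤ ∣ p ∩ q ∣ → p ⊆ q
∣p∣≤∣p∩q∣⇒p⊆q p q ∣p∣≤∣p∩q∣ {x} x∈p with x ∈? q
... | yes x∈q = x∈q
... | no  x∉q = contradiction ∣p∣≤∣p∩q∣ (<⇒≱ (p⊂q⇒∣p∣<∣q∣ p∩q⊂p))
  where
  p∩q⊂p : p ∩ q ⊂ p
  p∩q⊂p = p∩q⊆p p q , x , x∈p , x∉q ∘ proj₂ ∘ x∈p∩q⁻ p q

pad : ℕ → Subset m → Subset m
pad zero    p             = p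
pad (suc c) []            = []
pad (suc c) (inside ∷ p)  = inside ∷ pad (suc c) p
pad (suc c) (outside ∷ p) = inside ∷ pad c p

p⊆pad : ∀ c (p : Subset m) → p ⊆ pad c p
p⊆pad zero    p             x∈p         = x∈p
p⊆pad (suc c) (inside ∷ p)  here        = here
p⊆pad (suc c) (inside ∷ p)  (there x∈p) = there (p⊆pad (suc c) p x∈p)
p⊆pad (suc c) (outside ∷ p) (there x∈p) = there (p⊆pad c p x∈p)

∣pad∣ : ∀ c (p : Subset m) → ∣ p ∣ + c ≤ m → ∣ pad c p ∣ ≡ ∣ p ∣ + c
∣pad∣ zero    p             _     = sym (+-identityʳ ∣ p ∣)
∣pad∣ (suc c) []            ()
∣pad∣ (suc c) (inside ∷ p)  (s≤s ∣p∣+c≤m) = cong suc (∣pad∣ (suc c) p ∣p∣+c≤m)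
∣pad∣ {suc m} (suc c) (outside ∷ p) ∣p∣+1+c≤1+m =
  trans (cong suc (∣pad∣ c p ∣p∣+c≤m)) (sym (+-suc ∣ p ∣ c))
  where
  ∣p∣+c≤m : ∣ p ∣ + c ≤ m
  ∣p∣+c≤m = s≤s⁻¹ (subst (_≤ suc m) (+-suc ∣ p ∣ c) ∣p∣+1+c≤1+m)

superset-of-size : ∀ (p : Subset m) {c} → ∣ p ∣ ≤ c → c ≤ m → ∃[ q ] p ⊆ q × ∣ q ∣ ≡ c
superset-of-size p {c} ∣p∣≤c c≤m =
  pad (c ∸ ∣ p ∣) p , p⊆pad _ p ,
  trans (∣pad∣ _ p (subst (_≤ _) (sym (m+[n∸m]≡n ∣p∣≤c)) c≤m)) (m+[n∸m]≡n ∣p∣≤c)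

∈-tabulate⁻ : ∀ (f : Fin m → Bool) {x} → x ∈ tabulate f → f x ≡ true
∈-tabulate⁻ f {x} x∈ = trans (sym (lookup∘tabulate f x)) ([]=⇒lookup x∈)

∈-allSubsets : ∀ (p : Subset m) → p ∈ˡ allSubsets m
∈-allSubsets []            = hereˡ refl
∈-allSubsets (inside ∷ p)  = ∈-++⁺ˡ (∈-map⁺ (inside ∷_) (∈-allSubsets p))
∈-allSubsets (outside ∷ p) = ∈-++⁺ʳ _ (∈-map⁺ (outside ∷_) (∈-allSubsets p))

minimumℚ-≤ : ∀ {x xs} → x ∈ˡ xs → minimumℚ xs ℚ.≤ x
minimumℚ-≤ {xs = x ∷ˡ []ˡ}      (hereˡ refl) = ℚ.≤-refl
minimumℚ-≤ {xs = x ∷ˡ _ ∷ˡ _}   (hereˡ refl) = ℚ.p⊓q≤p x _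
minimumℚ-≤ {xs = x ∷ˡ _ ∷ˡ _}   (thereˡ x∈) = ℚ.≤-trans (ℚ.p⊓q≤q x _) (minimumℚ-≤ x∈)

∈N⇒adj : ∀ G {v w} → v ∈ N G w → adj G w v ≡ true
∈N⇒adj G {w = w} = ∈-tabulate⁻ (adj G w)

∈Λ⇒k≤∣S∩N∣ : ∀ k G (S : Subset (n G)) {w} → w ∈ Λ k G S → k ≤ ∣ S ∩ N G w ∣
∈Λ⇒k≤∣S∩N∣ k G S {w} w∈Λ =
  ≤ᵇ⇒≤ k _ (from T-≡ (∈-tabulate⁻ (λ u → k ≤ᵇ ∣ S ∩ N G u ∣) w∈Λ))

∣S∣≤k∧∈Λ⇒S⊆N : ∀ k G (S : Subset (n G)) {w} → ∣ S ∣ ≤ k → w ∈ Λ k G S → S ⊆ N G w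
∣S∣≤k∧∈Λ⇒S⊆N k G S {w} ∣S∣≤k w∈Λ =
  ∣p∣≤∣p∩q∣⇒p⊆q S (N G w) (≤-trans ∣S∣≤k (∈Λ⇒k≤∣S∩N∣ k G S w∈Λ))

admissible⇒k≤∣S∣ : ∀ k G (S : Subset (n G)) → admissible k G S ≡ true → k ≤ ∣ S ∣
admissible⇒k≤∣S∣ k G S adm = ≤ᵇ⇒≤ k ∣ S ∣ (proj₁ (to T-∧ (from T-≡ adm)))

Empty-Λ⇒admissible : ∀ k G (S : Subset (n G)) →
                     k ≤ ∣ S ∣ → Empty (Λ k G S) → Fin (n G) → admissible k G S ≡ true
Empty-Λ⇒admissible k G S k≤∣S∣ Λ-empty v =
  cong₂ (λ a b → a ∧ not b) (to T-≡ (≤⇒≤ᵇ k≤∣S∣)) (dec-false (≡-dec _≟𝔹_ (Λ k G S) ⊤) Λ≢⊤)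
  where
  Λ≢⊤ : Λ k G S ≢ ⊤
  Λ≢⊤ Λ≡⊤ = Λ-empty (v , subst (v ∈_) (sym Λ≡⊤) ∈⊤)

Empty-Λ⇒ratio≡0 : ∀ k G (S : Subset (n G)) → Empty (Λ k G S) → ratio k G S ≡ 0ℚ
Empty-Λ⇒ratio≡0 k G S Λ-empty with ∣ S ∣
... | zero  = refl
... | suc s rewrite Empty-unique Λ-empty | ∣⊥∣≡0 (n G) = ℚ.0/n≡0 (suc s)

β≤ratio : ∀ k G (S : Subset (n G)) → admissible k G S ≡ true → β k G ℚ.≤ ratio k G S
β≤ratio k G S adm with n G <ᵇ k in n<ᵇk
... | true  = contradiction (≤-trans (admissible⇒k≤∣S∣ k G S adm) (∣p∣≤n S))
                            (<⇒≱ (<ᵇ⇒< (n G) k (from T-≡ n<ᵇk)))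
... | false = minimumℚ-≤ (∈-map⁺ (ratio k G)
                (∈-filter⁺ (λ S → admissible k G S ≟𝔹 true) (∈-allSubsets S) adm))

0<β⇒k≤n : ∀ k G → 0ℚ < β k G → k ≤ n G
0<β⇒k≤n k G 0<β with n G <ᵇ k in n<ᵇk
... | true  = contradiction 0<β (ℚ.<-irrefl refl)
... | false = ≮⇒≥ (λ n<k → subst T n<ᵇk (<⇒<ᵇ n<k))

0<β⇒Λ-nonempty : ∀ k G (S : Subset (n G)) → 0ℚ < β k G → k ≤ ∣ S ∣ → Fin (n G) → Nonempty (Λ k G S)
0<β⇒Λ-nonempty k G S 0<β k≤∣S∣ v with nonempty? (Λ k G S)
... | yes Λ-nonempty = Λ-nonempty
... | no  Λ-empty    = contradiction (ℚ.<-≤-trans 0<β β≤0) (ℚ.<-irrefl refl)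
  where
  β≤0 : β k G ℚ.≤ 0ℚ
  β≤0 = ℚ.≤-trans (β≤ratio k G S (Empty-Λ⇒admissible k G S k≤∣S∣ Λ-empty v))
                  (ℚ.≤-reflexive (Empty-Λ⇒ratio≡0 k G S Λ-empty))

0<β⇒common-neighbour-of-k-set : ∀ k G (S : Subset (n G)) → 0ℚ < β k G → ∣ S ∣ ≡ k →
                                Fin (n G) → ∃[ w ] S ⊆ N G w
0<β⇒common-neighbour-of-k-set k G S 0<β ∣S∣≡k v =
  let w , w∈Λ = 0<β⇒Λ-nonempty k G S 0<β (≤-reflexive (sym ∣S∣≡k)) v
  in  w , ∣S∣≤k∧∈Λ⇒S⊆N k G S (≤-reflexive ∣S∣≡k) w∈Λ

0<β⇒common-neighbour : ∀ k G → 2 ≤ k → 0ℚ < β k G →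
                       ∀ u v → ∃[ w ] adj G u w ≡ true × adj G w v ≡ true
0<β⇒common-neighbour k G 2≤k 0<β u v =
  let S , uv⊆S , ∣S∣≡k = superset-of-size (⁅ u ⁆ ∪ ⁅ v ⁆) ∣uv∣≤k (0<β⇒k≤n k G 0<β)
      w , S⊆Nw        = 0<β⇒common-neighbour-of-k-set k G S 0<β ∣S∣≡k u
  in  w , trans (Graph.sym G u w) (∈N⇒adj G (S⊆Nw (uv⊆S (p⊆p∪q ⁅ v ⁆ (x∈⁅x⁆ u)))))
        , ∈N⇒adj G (S⊆Nw (uv⊆S (q⊆p∪q ⁅ u ⁆ ⁅ v ⁆ (x∈⁅x⁆ v))))
  where
  ∣uv∣≤k : ∣ ⁅ u ⁆ ∪ ⁅ v ⁆ ∣ ≤ k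
  ∣uv∣≤k = ≤-trans (∣p∪q∣≤∣p∣+∣q∣ ⁅ u ⁆ ⁅ v ⁆)
                   (subst (_≤ k) (sym (cong₂ _+_ (∣⁅x⁆∣≡1 u) (∣⁅x⁆∣≡1 v))) 2≤k)

corollary2p4 : (k : ℕ) → 2 ≤ k → (G : Graph) → 0ℚ < β k G → Connected G
corollary2p4 k 2≤k G 0<β u v with w , uw , wv ← 0<β⇒common-neighbour k G 2≤k 0<β u v =
  step uw (step wv here)
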